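{- Let $k\geq 2$ be an integer and let $H_k$ be the $k$-uniform hypergraph with vertex set $[2k-1]=\{1,\dots,2k-1\}$ and edge set $\binom{[2k-1]}{k}\setminus\{\{1,2,\ldots,k\},\{1,k+1,k+2,\ldots,2k-1\}\}$. Then: (1) $H_k$ does not contain two (distinct) copies of $K^k_{2k-2}$; (2) $|E(H_k)|\geq t(2k-1,2k-2,k)+1$.
   Context: For integers $n,s,k$, the Turán number $t(n,s,k)$ is the maximum number of edges in a $k$-uniform hypergraph on $n$ vertices which does not contain the complete $k$-uniform hypergraph $K^k_s$ on $s$ vertices as a subgraph. $\binom{X}{k}$ denotes the set of $k$-element subsets of $X$. -}

module Defs where

open import Data.Nat using (ℕ; zero; suc; _+_; _*_; _∸_; _≤_; _<ᵇ_; _≡ᵇ_; _≤ᵇ_)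
open import Data.Nat.Properties using (≡ᵇ⇒≡)
open import Data.Bool using (Bool; true; false; _∧_; _∨_; not; if_then_else_; T)
open import Data.Bool.Properties using () renaming (_≟_ to _≟𝔹_)
open import Data.Fin using (Fin; toℕ)
open import Data.Fin.Subset using (Subset; inside; outside; ∣_∣; _⊆_)
open import Data.Vec using (Vec; []; _∷_; tabulate)
open import Data.Vec.Properties using (≡-dec)
open import Data.List using (List; [_]; _++_; map; length; filterᵇ)
open import Data.Product using (Σ; _×_; ∃; _,_)
open import Relation.Nullary using (¬_; ⌊_⌋)
open import Relation.Binary.PropositionalEquality using (_≡_; refl)

allSubsets : (n : ℕ) → List (Subset n)
allSubsets zero = [ [] ]
allSubsets (suc n) = map (outside ∷_) (allSubsets n) ++ map (inside ∷_) (allSubsets n)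

record Hypergraph (n k : ℕ) : Set where
  field
    edge    : Subset n → Bool
    uniform : ∀ e → edge e ≡ true → ∣ e ∣ ≡ k
open Hypergraph public

numEdges : ∀ {n k} → Hypergraph n k → ℕ
numEdges {n} G = length (filterᵇ (edge G) (allSubsets n))

IsClique : ∀ {n k} → Hypergraph n k → ℕ → Subset n → Set
IsClique {n} {k} G s S = (∣ S ∣ ≡ s) × (∀ e → e ⊆ S → ∣ e ∣ ≡ k → edge G e ≡ true)

ContainsClique : ∀ {n k} → Hypergraph n k → ℕ → Set
ContainsClique {n} G s = ∃ λ (S : Subset n) → IsClique G s S

IsTuranNumber : ℕ → ℕ → ℕ → ℕ → Set
IsTuranNumber n s k t =
  (∃ λ (G : Hypergraph n k) → ¬ ContainsClique G s × numEdges G ≡ t)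
  × (∀ (G : Hypergraph n k) → ¬ ContainsClique G s → numEdges G ≤ t)

_≡ˢ_ : ∀ {n} → Subset n → Subset n → Bool
a ≡ˢ b = ⌊ ≡-dec _≟𝔹_ a b ⌋

-- Vertices 1..2k-1 of the paper are Fin (2k-1) indices 0..2k-2 (vertex i+1 ↦ i).
-- {1,...,k}
removed₁ : (k : ℕ) → Subset (2 * k ∸ 1)
removed₁ k = tabulate (λ i → if toℕ i <ᵇ k then inside else outside)

-- {1, k+1, ..., 2k-1}
removed₂ : (k : ℕ) → Subset (2 * k ∸ 1)
removed₂ k = tabulate (λ i → if (toℕ i ≡ᵇ 0) ∨ (k ≤ᵇ toℕ i) then inside else outside)

Hedge : (k : ℕ) → Subset (2 * k ∸ 1) → Bool
Hedge k e = (∣ e ∣ ≡ᵇ k) ∧ (not (e ≡ˢ removed₁ k) ∧ not (e ≡ˢ removed₂ k))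

private
  Hedge-uniform : ∀ k e → Hedge k e ≡ true → ∣ e ∣ ≡ k
  Hedge-uniform k e p with ∣ e ∣ ≡ᵇ k in q
  ... | true = ≡ᵇ⇒≡ ∣ e ∣ k (subst′ q)
    where
      subst′ : ∀ {b} → b ≡ true → T b
      subst′ refl = _
  ... | false with p
  ... | ()

H : (k : ℕ) → Hypergraph (2 * k ∸ 1) k
H k = record { edge = Hedge k ; uniform = Hedge-uniform k }

-- H_k (k ≥ 2) lives on Fin (2k-1); its edges are all k-sets except
-- A = {0,…,k-1} and B = {0,k,…,2k-2} (the paper's vertex i+1 is i here).
-- Two facts about a k-graph G on suc n vertices drive the proof:
--  * a set of n vertices is the complement ∁⁅v⁆ of one vertex v, and if it
--    spans a clique then v lies in every non-edge;
--  * if G is K^k_n-free, every vertex is avoided by a non-edge, so for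
--    suc n < 2k there are three distinct non-edges (e₁; e₂ avoiding a vertex
--    of e₁; e₃ avoiding a vertex of e₁ ∩ e₂), i.e. |E(G)| + 3 ≤ C(suc n, k).
-- Part (1): for H_k the first fact forces v ∈ A ∩ B = {0}. Part (2): since
-- |E(H_k)| + 2 = C(2k-1, k), the second fact applied to an extremal graph
-- gives t + 1 ≤ |E(H_k)|; the non-edges are found under double negation,
-- which suffices as the inequality is decidable.
module Submission where

open import Defs
open import Data.Bool using (Bool; true; false; _∧_; _∨_; not; if_then_else_; T)
open import Data.Bool.Properties using (∧-zeroʳ; ∧-identityʳ; ∧-assoc; T-≡; T-∨)
  renaming (_≟_ to _≟𝔹_)
open import Data.Empty using (⊥-elim)
open import Data.Fin using (Fin; zero; suc; toℕ; fromℕ)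
open import Data.Fin.Properties using (toℕ-injective; toℕ-fromℕ; ¬∀⟶∃¬)
open import Data.Fin.Subset using (Subset; inside; outside; ∣_∣; _∈_; _∉_; _⊆_; ∁; ⁅_⁆; _∩_; ⊤; Nonempty)
open import Data.Fin.Subset.Properties
  using (_∈?_; nonempty?; Empty-unique; ∣⊥∣≡0; ∣⊤∣≡n; ⊆⊤; ⊆-antisym; ∣p∣≤n; p⊆q⇒∣p∣≤∣q∣; p⊂q⇒∣p∣<∣q∣;
         ∣∁p∣≡n∸∣p∣; ∣⁅x⁆∣≡1; x∈⁅x⁆; x≢y⇒x∉⁅y⁆; x∉p⇒x∈∁p; x∈∁p⇒x∉p; x∈p∩q⁺; x∈p∩q⁻)
open import Data.List using (List; []; _∷_; _++_; map; length; filterᵇ)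
open import Data.List.Relation.Unary.All as All using (All; []; _∷_)
open import Data.List.Relation.Unary.AllPairs using ([]; _∷_)
open import Data.List.Relation.Unary.Unique.Propositional using (Unique)
open import Data.Nat using (ℕ; zero; suc; _+_; _*_; _∸_; _≤_; _<_; z≤n; s≤s; _<ᵇ_; _≡ᵇ_; _≤ᵇ_; _≤?_)
open import Data.Nat.Properties
  using (+-suc; +-comm; +-assoc; +-identityʳ; +-cancelʳ-≤; ≤-reflexive; ≤-trans; n≤1+n; m≤n+m; ≤⇒≤ᵇ;
         <⇒≱; <⇒≢; >⇒≢; 1+n≢n; m≤o∸n⇒m+n≤o; m+n∸m≡n; ≡ᵇ⇒≡; ≡⇒≡ᵇ; <ᵇ⇒<; ≤ᵇ⇒≤; module ≤-Reasoning)
open import Data.Product using (Σ; _×_; ∃; _,_)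
open import Data.Sum using (_⊎_; inj₂; [_,_]′)
import Data.Sum as Sum
open import Data.Vec using ([]; _∷_; tabulate)
open import Data.Vec.Properties using (≡-dec; lookup∘tabulate; []=⇒lookup; lookup⇒[]=)
open import Effect.Monad using (RawMonad)
open import Level using (0ℓ)
open import Function using (_∘_; id; Equivalence)
open import Relation.Nullary using (¬_; yes; no; does; contradiction)
open import Relation.Nullary.Decidable using (decidable-stable; isYes≗does; dec-true; dec-false; toWitness)
open import Relation.Nullary.Negation using (¬¬-Monad; ¬¬-map)
open import Relation.Binary.PropositionalEquality
  using (_≡_; _≢_; refl; sym; trans; cong; cong₂; subst; ≢-sym; module ≡-Reasoning)

count : {A : Set} → (A → Bool) → List A → ℕ
count p xs = length (filterᵇ p xs)

module _ {A : Set} where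

  count-mono : {p q : A → Bool} → (∀ x → p x ≡ true → q x ≡ true) → ∀ xs → count p xs ≤ count q xs
  count-mono p⇒q [] = z≤n
  count-mono {p} {q} p⇒q (x ∷ xs) with p x in px | q x in qx
  ... | true  | true  = s≤s (count-mono p⇒q xs)
  ... | false | true  = ≤-trans (count-mono p⇒q xs) (n≤1+n _)
  ... | false | false = count-mono p⇒q xs
  ... | true  | false = contradiction (trans (sym (p⇒q x px)) qx) λ ()

  count-cong : {p q : A → Bool} → (∀ x → p x ≡ q x) → ∀ xs → count p xs ≡ count q xs
  count-cong p≗q [] = refl
  count-cong {p} {q} p≗q (x ∷ xs) with p x | q x | p≗q x
  ... | true  | .true  | refl = cong suc (count-cong p≗q xs)
  ... | false | .false | refl = count-cong p≗q xs

  count-split : (q r : A → Bool) → ∀ xs →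
    count q xs ≡ count (λ x → q x ∧ not (r x)) xs + count (λ x → q x ∧ r x) xs
  count-split q r [] = refl
  count-split q r (x ∷ xs) with q x | r x
  ... | true  | true  = trans (cong suc (count-split q r xs)) (sym (+-suc _ _))
  ... | true  | false = cong suc (count-split q r xs)
  ... | false | _     = count-split q r xs

  count-++ : (p : A → Bool) → ∀ xs ys → count p (xs ++ ys) ≡ count p xs + count p ys
  count-++ p [] ys = refl
  count-++ p (x ∷ xs) ys with p x
  ... | true  = cong suc (count-++ p xs ys)
  ... | false = count-++ p xs ys

  count-false : ∀ xs → count (λ (_ : A) → false) xs ≡ 0
  count-false [] = refl
  count-false (_ ∷ xs) = count-false xs

count-map : {A B : Set} (p : B → Bool) (f : A → B) → ∀ xs → count p (map f xs) ≡ count (p ∘ f) xs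
count-map p f [] = refl
count-map p f (x ∷ xs) with p (f x)
... | true  = cong suc (count-map p f xs)
... | false = count-map p f xs

module _ {n : ℕ} {x y : Subset n} where

  ≡ˢ-sound : (x ≡ˢ y) ≡ true → x ≡ y
  ≡ˢ-sound x≐y = toWitness (Equivalence.from T-≡ x≐y)

  ≡ˢ-false : x ≢ y → (x ≡ˢ y) ≡ false
  ≡ˢ-false x≢y = trans (isYes≗does (≡-dec _≟𝔹_ x y)) (dec-false (≡-dec _≟𝔹_ x y) x≢y)

≡ˢ-refl : ∀ {n} {x : Subset n} → (x ≡ˢ x) ≡ true
≡ˢ-refl {x = x} = trans (isYes≗does (≡-dec _≟𝔹_ x x)) (dec-true (≡-dec _≟𝔹_ x x) refl)

≡ˢ-∷ : ∀ {n} a b (x y : Subset n) → ((a ∷ x) ≡ˢ (b ∷ y)) ≡ (does (a ≟𝔹 b) ∧ (x ≡ˢ y))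
≡ˢ-∷ a b x y = trans (isYes≗does _) (cong (does (a ≟𝔹 b) ∧_) (sym (isYes≗does _)))

allSubsets-once : ∀ n (e : Subset n) → count (_≡ˢ e) (allSubsets n) ≡ 1
allSubsets-once zero [] = refl
allSubsets-once (suc n) (b ∷ e) = begin
  count (_≡ˢ (b ∷ e)) (map (outside ∷_) xs ++ map (inside ∷_) xs)
    ≡⟨ count-++ (_≡ˢ (b ∷ e)) (map (outside ∷_) xs) (map (inside ∷_) xs) ⟩
  count (_≡ˢ (b ∷ e)) (map (outside ∷_) xs) + count (_≡ˢ (b ∷ e)) (map (inside ∷_) xs)
    ≡⟨ cong₂ _+_ (with-head outside) (with-head inside) ⟩
  count (λ x → does (outside ≟𝔹 b) ∧ (x ≡ˢ e)) xs + count (λ x → does (inside ≟𝔹 b) ∧ (x ≡ˢ e)) xs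
    ≡⟨ only-head-b b ⟩
  1 ∎
  where
    open ≡-Reasoning
    xs : List (Subset n)
    xs = allSubsets n
    with-head : ∀ c → count (_≡ˢ (b ∷ e)) (map (c ∷_) xs) ≡ count (λ x → does (c ≟𝔹 b) ∧ (x ≡ˢ e)) xs
    with-head c = trans (count-map _ (c ∷_) xs) (count-cong (λ x → ≡ˢ-∷ c b x e) xs)
    only-head-b : ∀ b → count (λ x → does (outside ≟𝔹 b) ∧ (x ≡ˢ e)) xs
                        + count (λ x → does (inside ≟𝔹 b) ∧ (x ≡ˢ e)) xs ≡ 1
    only-head-b false = cong₂ _+_ (allSubsets-once n e) (count-false xs)
    only-head-b true  = cong₂ _+_ (count-false xs) (allSubsets-once n e)

_without_ : ∀ {n} → (Subset n → Bool) → Subset n → Subset n → Bool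
(q without e) x = q x ∧ not (x ≡ˢ e)

without-keeps : ∀ {n} (q : Subset n → Bool) {e x} → q x ≡ true → x ≢ e → (q without e) x ≡ true
without-keeps q qx x≢e = cong₂ (λ a b → a ∧ not b) qx (≡ˢ-false x≢e)

count-without : ∀ {n} (q : Subset n → Bool) {e} → q e ≡ true →
  count q (allSubsets n) ≡ count (q without e) (allSubsets n) + 1
count-without {n} q {e} qe = begin
  count q xs                                              ≡⟨ count-split q (_≡ˢ e) xs ⟩
  count (q without e) xs + count (λ x → q x ∧ (x ≡ˢ e)) xs ≡⟨ cong (count (q without e) xs +_) just-e ⟩
  count (q without e) xs + 1                              ∎
  where
    open ≡-Reasoning
    xs : List (Subset n)
    xs = allSubsets n
    q∧≡e : ∀ x → (q x ∧ (x ≡ˢ e)) ≡ (x ≡ˢ e)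
    q∧≡e x with x ≡ˢ e in x≐e
    ... | false = ∧-zeroʳ (q x)
    ... | true  = trans (∧-identityʳ (q x)) (trans (cong q (≡ˢ-sound x≐e)) qe)
    just-e : count (λ x → q x ∧ (x ≡ˢ e)) xs ≡ 1
    just-e = trans (count-cong q∧≡e xs) (allSubsets-once n e)

count-gap : ∀ {n} (p q : Subset n → Bool) → (∀ x → p x ≡ true → q x ≡ true) →
  ∀ {es} → Unique es → All (λ e → q e ≡ true × p e ≡ false) es →
  count p (allSubsets n) + length es ≤ count q (allSubsets n)
count-gap {n} p q p⇒q {[]} [] [] = ≤-trans (≤-reflexive (+-identityʳ _)) (count-mono p⇒q (allSubsets n))
count-gap {n} p q p⇒q {e ∷ es} (e≢es ∷ unique) ((qe , ¬pe) ∷ gaps) = begin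
  count p xs + suc (length es)   ≡⟨ +-suc _ (length es) ⟩
  suc (count p xs + length es)   ≤⟨ s≤s (count-gap p (q without e) p⇒q∖e unique gaps∖e) ⟩
  suc (count (q without e) xs)   ≡⟨ +-comm 1 _ ⟩
  count (q without e) xs + 1     ≡⟨ sym (count-without q qe) ⟩
  count q xs                     ∎
  where
    open ≤-Reasoning
    xs : List (Subset n)
    xs = allSubsets n
    p⇒q∖e : ∀ x → p x ≡ true → (q without e) x ≡ true
    p⇒q∖e x px = without-keeps q (p⇒q x px) λ { refl → contradiction (trans (sym px) ¬pe) λ () }
    gaps∖e : All (λ e′ → (q without e) e′ ≡ true × p e′ ≡ false) es
    gaps∖e = All.zipWith (λ (e≢e′ , qe′ , ¬pe′) → without-keeps q qe′ (≢-sym e≢e′) , ¬pe′) (e≢es , gaps)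

∣∁⁅v⁆∣ : ∀ {n} (v : Fin (suc n)) → ∣ ∁ ⁅ v ⁆ ∣ ≡ n
∣∁⁅v⁆∣ {n} v = trans (∣∁p∣≡n∸∣p∣ ⁅ v ⁆) (cong (suc n ∸_) (∣⁅x⁆∣≡1 v))

module _ {n : ℕ} {v : Fin n} {e : Subset n} where

  ∉⇒⊆∁⁅⁆ : v ∉ e → e ⊆ ∁ ⁅ v ⁆
  ∉⇒⊆∁⁅⁆ v∉e x∈e = x∉p⇒x∈∁p (x≢y⇒x∉⁅y⁆ λ { refl → v∉e x∈e })

  ⊆∁⁅⁆⇒∉ : e ⊆ ∁ ⁅ v ⁆ → v ∉ e
  ⊆∁⁅⁆⇒∉ e⊆∁v v∈e = x∈∁p⇒x∉p (e⊆∁v v∈e) (x∈⁅x⁆ v)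

missing-point : ∀ {n} (S : Subset (suc n)) → ∣ S ∣ ≡ n → ∃ λ v → v ∉ S
missing-point {n} S ∣S∣≡n = ¬∀⟶∃¬ (suc n) (_∈ S) (_∈? S) S≢⊤
  where
    open ≡-Reasoning
    S≢⊤ : ¬ (∀ x → x ∈ S)
    S≢⊤ all∈S = 1+n≢n (begin
      suc n     ≡⟨ sym (∣⊤∣≡n (suc n)) ⟩
      ∣ ⊤ {suc n} ∣ ≡⟨ cong ∣_∣ (⊆-antisym (λ {x} _ → all∈S x) ⊆⊤) ⟩
      ∣ S ∣     ≡⟨ ∣S∣≡n ⟩
      n         ∎)

-- A set of n points of Fin (suc n) contains every point but the one it misses:
-- a further missing point would make it a proper subset of ∁⁅v⁆, of size < n.
∁⁅missing⁆⊆ : ∀ {n} (S : Subset (suc n)) → ∣ S ∣ ≡ n → ∀ {v} → v ∉ S → ∁ ⁅ v ⁆ ⊆ S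
∁⁅missing⁆⊆ {n} S ∣S∣≡n {v} v∉S {x} x∈∁v with x ∈? S
... | yes x∈S = x∈S
... | no  x∉S = contradiction ∣S∣≡n (<⇒≢ ∣S∣<n)
  where
    open ≤-Reasoning
    ∣S∣<n : ∣ S ∣ < n
    ∣S∣<n = begin-strict
      ∣ S ∣       <⟨ p⊂q⇒∣p∣<∣q∣ (∉⇒⊆∁⁅⁆ v∉S , x , x∈∁v , x∉S) ⟩
      ∣ ∁ ⁅ v ⁆ ∣ ≡⟨ ∣∁⁅v⁆∣ v ⟩
      n           ∎

co-point : ∀ {n} (S : Subset (suc n)) → ∣ S ∣ ≡ n → ∃ λ v → S ≡ ∁ ⁅ v ⁆
co-point S ∣S∣≡n with missing-point S ∣S∣≡n
... | v , v∉S = v , ⊆-antisym (∉⇒⊆∁⁅⁆ v∉S) (∁⁅missing⁆⊆ S ∣S∣≡n v∉S)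

nonempty-of-size : ∀ {n} (p : Subset n) → 0 < ∣ p ∣ → Nonempty p
nonempty-of-size {n} p 0<∣p∣ with nonempty? p
... | yes nonempty = nonempty
... | no  empty = contradiction (trans (cong ∣_∣ (Empty-unique empty)) (∣⊥∣≡0 n)) (>⇒≢ 0<∣p∣)

meet-of-size : ∀ {n} (p q : Subset n) → n < ∣ p ∣ + ∣ q ∣ → Nonempty (p ∩ q)
meet-of-size {n} p q n<∣p∣+∣q∣ with nonempty? (p ∩ q)
... | yes meet = meet
... | no  disjoint = contradiction ∣p∣+∣q∣≤n (<⇒≱ n<∣p∣+∣q∣)
  where
    p⊆∁q : p ⊆ ∁ q
    p⊆∁q x∈p = x∉p⇒x∈∁p (λ x∈q → disjoint (_ , x∈p∩q⁺ (x∈p , x∈q)))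
    ∣p∣+∣q∣≤n : ∣ p ∣ + ∣ q ∣ ≤ n
    ∣p∣+∣q∣≤n = m≤o∸n⇒m+n≤o ∣ p ∣ (∣p∣≤n q) (subst (∣ p ∣ ≤_) (∣∁p∣≡n∸∣p∣ q) (p⊆q⇒∣p∣≤∣q∣ p⊆∁q))

NonEdge : ∀ {n k} → Hypergraph n k → Subset n → Set
NonEdge {k = k} G e = ∣ e ∣ ≡ k × edge G e ≡ false

co-point-clique-meets : ∀ {n k s} (G : Hypergraph n k) {v e} →
  IsClique G s (∁ ⁅ v ⁆) → NonEdge G e → v ∈ e
co-point-clique-meets G {v} {e} (_ , all-edges) (∣e∣≡k , not-edge) with v ∈? e
... | yes v∈e = v∈e
... | no  v∉e = contradiction (trans (sym (all-edges e (∉⇒⊆∁⁅⁆ v∉e) ∣e∣≡k)) not-edge) λ ()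

-- In a K^k_n-free k-graph on suc n vertices every vertex v is avoided by a
-- non-edge, for otherwise ∁⁅v⁆ would span a clique. The non-edge is only
-- obtained under double negation.
avoiding-nonEdge : ∀ {n k} (G : Hypergraph (suc n) k) → ¬ ContainsClique G n →
  ∀ v → ¬ ¬ (∃ λ e → v ∉ e × NonEdge G e)
avoiding-nonEdge {k = k} G K-free v none = K-free (∁ ⁅ v ⁆ , ∣∁⁅v⁆∣ v , all-edges)
  where
    all-edges : ∀ e → e ⊆ ∁ ⁅ v ⁆ → ∣ e ∣ ≡ k → edge G e ≡ true
    all-edges e e⊆∁v ∣e∣≡k with edge G e in e-edge
    ... | true  = refl
    ... | false = ⊥-elim (none (e , ⊆∁⁅⁆⇒∉ e⊆∁v , ∣e∣≡k , e-edge))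

-- A K^k_n-free k-graph on suc n < 2k vertices (k ≥ 1) has three distinct
-- non-edges: e₁; e₂ avoiding a vertex v₂ ∈ e₁; e₃ avoiding a vertex v₃ of e₁ ∩ e₂.
three-nonEdges : ∀ {n k} (G : Hypergraph (suc n) k) → 0 < k → suc n < k + k → ¬ ContainsClique G n →
  ¬ ¬ (∃ λ es → Unique es × All (NonEdge G) es × length es ≡ 3)
three-nonEdges {n} G 0<k suc-n<2k K-free = do
    (e₁ , _ , ne₁@(∣e₁∣≡k , _)) ← avoiding-nonEdge G K-free zero
    let (v₂ , v₂∈e₁) = nonempty-of-size e₁ (subst (0 <_) (sym ∣e₁∣≡k) 0<k)
    (e₂ , v₂∉e₂ , ne₂@(∣e₂∣≡k , _)) ← avoiding-nonEdge G K-free v₂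
    let (v₃ , v₃∈e₁∩e₂) = meet-of-size e₁ e₂ (subst (suc n <_) (sym (cong₂ _+_ ∣e₁∣≡k ∣e₂∣≡k)) suc-n<2k)
        (v₃∈e₁ , v₃∈e₂) = x∈p∩q⁻ e₁ e₂ v₃∈e₁∩e₂
    (e₃ , v₃∉e₃ , ne₃) ← avoiding-nonEdge G K-free v₃
    pure ( e₁ ∷ e₂ ∷ e₃ ∷ []
         , (separated v₂∈e₁ v₂∉e₂ ∷ separated v₃∈e₁ v₃∉e₃ ∷ []) ∷ (separated v₃∈e₂ v₃∉e₃ ∷ []) ∷ [] ∷ []
         , ne₁ ∷ ne₂ ∷ ne₃ ∷ []
         , refl )
  where
    open RawMonad (¬¬-Monad {a = 0ℓ})
    separated : ∀ {v : Fin (suc n)} {a b} → v ∈ a → v ∉ b → a ≢ b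
    separated v∈a v∉b refl = v∉b v∈a

-- Boolean test for being a k-set; count (isKSet k) (allSubsets n) is C(n,k).
isKSet : ∀ {n} → ℕ → Subset n → Bool
isKSet k x = ∣ x ∣ ≡ᵇ k

isKSet-true : ∀ {n k} (x : Subset n) → ∣ x ∣ ≡ k → isKSet k x ≡ true
isKSet-true x ∣x∣≡k = Equivalence.to T-≡ (≡⇒≡ᵇ _ _ ∣x∣≡k)

K-free-edge-bound : ∀ {n k} (G : Hypergraph (suc n) k) → 0 < k → suc n < k + k → ¬ ContainsClique G n →
  numEdges G + 3 ≤ count (isKSet k) (allSubsets (suc n))
K-free-edge-bound {n} {k} G 0<k suc-n<2k K-free =
  decidable-stable (_ ≤? _) (¬¬-map bound (three-nonEdges G 0<k suc-n<2k K-free))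
  where
    bound : (∃ λ es → Unique es × All (NonEdge G) es × length es ≡ 3) →
            numEdges G + 3 ≤ count (isKSet k) (allSubsets (suc n))
    bound (es , unique , nonEdges , length≡3) =
      subst (λ l → numEdges G + l ≤ _) length≡3
        (count-gap (edge G) (isKSet k) (λ e e-edge → isKSet-true e (uniform G e e-edge)) unique
          (All.map (λ {e} (∣e∣≡k , not-edge) → isKSet-true e ∣e∣≡k , not-edge) nonEdges))

select : ∀ {N} → (Fin N → Bool) → Subset N
select b = tabulate (λ i → if b i then inside else outside)

module _ {N : ℕ} (b : Fin N → Bool) (x : Fin N) where

  ∈-select : x ∈ select b → T (b x)
  ∈-select x∈ = bit (b x) (trans (sym (lookup∘tabulate _ x)) ([]=⇒lookup x∈))
    where
      bit : ∀ c → (if c then inside else outside) ≡ inside → T c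
      bit true _ = _

  select-∈ : T (b x) → x ∈ select b
  select-∈ bx = lookup⇒[]= x _ (trans (lookup∘tabulate _ x) (bit (b x) bx))
    where
      bit : ∀ c → T c → (if c then inside else outside) ≡ inside
      bit true _ = refl

∣initial-segment∣ : ∀ N k → k ≤ N → ∣ select {N} (λ i → toℕ i <ᵇ k) ∣ ≡ k
∣initial-segment∣ zero    zero    _         = refl
∣initial-segment∣ (suc N) zero    _         = ∣initial-segment∣ N zero z≤n
∣initial-segment∣ (suc N) (suc k) (s≤s k≤N) = cong suc (∣initial-segment∣ N k k≤N)

∣final-segment∣ : ∀ N j → ∣ select {N} (λ i → j <ᵇ suc (toℕ i)) ∣ ≡ N ∸ j
∣final-segment∣ zero    zero    = refl
∣final-segment∣ zero    (suc j) = refl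
∣final-segment∣ (suc N) zero    = cong suc (∣final-segment∣ N zero)
∣final-segment∣ (suc N) (suc j) = ∣final-segment∣ N j

removed₁-member : ∀ {k} {v : Fin (2 * k ∸ 1)} → v ∈ removed₁ k → toℕ v < k
removed₁-member {k} {v} v∈A = <ᵇ⇒< (toℕ v) k (∈-select _ v v∈A)

removed₂-member : ∀ {k} {v : Fin (2 * k ∸ 1)} → v ∈ removed₂ k → toℕ v ≡ 0 ⊎ k ≤ toℕ v
removed₂-member {k} {v} v∈B =
  Sum.map (≡ᵇ⇒≡ (toℕ v) 0) (≤ᵇ⇒≤ k (toℕ v)) (Equivalence.to T-∨ (∈-select _ v v∈B))

A∩B-vertex : ∀ {a k} → a < k → a ≡ 0 ⊎ k ≤ a → a ≡ 0
A∩B-vertex a<k = [ id , (λ k≤a → contradiction k≤a (<⇒≱ a<k)) ]′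

module Hₖ (m : ℕ) where

  k N′ N : ℕ
  k  = 2 + m
  N′ = 2 * k ∸ 2
  N  = 2 * k ∸ 1

  A B : Subset N
  A = removed₁ k
  B = removed₂ k

  N′≡k-1+k-1 : N′ ≡ suc m + suc m
  N′≡k-1+k-1 = trans (cong (λ x → m + suc (suc x)) (+-identityʳ m)) (+-suc m (suc m))

  k≤N′ : k ≤ N′
  k≤N′ = subst (k ≤_) (sym N′≡k-1+k-1) (s≤s (m≤n+m (suc m) m))

  N<k+k : N < k + k
  N<k+k = s≤s (s≤s (≤-reflexive (trans N′≡k-1+k-1 (sym (+-suc m (suc m))))))

  ∣A∣ : ∣ A ∣ ≡ k
  ∣A∣ = ∣initial-segment∣ N k (≤-trans k≤N′ (n≤1+n N′))

  -- B is vertex 0 followed by the final segment {k,…,2k-2} of the remaining N′ vertices.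
  ∣B∣ : ∣ B ∣ ≡ k
  ∣B∣ = cong suc (begin
    ∣ select {N′} (λ i → suc m <ᵇ suc (toℕ i)) ∣ ≡⟨ ∣final-segment∣ N′ (suc m) ⟩
    N′ ∸ suc m                                    ≡⟨ cong (_∸ suc m) N′≡k-1+k-1 ⟩
    suc m + suc m ∸ suc m                         ≡⟨ m+n∸m≡n (suc m) (suc m) ⟩
    suc m                                         ∎)
    where open ≡-Reasoning

  -- The last vertex lies in B but not in A.
  B≢A : B ≢ A
  B≢A B≡A = <⇒≱ (removed₁-member (subst (last ∈_) B≡A last∈B)) k≤last
    where
      last : Fin N
      last = fromℕ N′
      k≤last : k ≤ toℕ last
      k≤last = subst (k ≤_) (sym (toℕ-fromℕ N′)) k≤N′
      last∈B : last ∈ B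
      last∈B = select-∈ (λ i → (toℕ i ≡ᵇ 0) ∨ (k ≤ᵇ toℕ i)) last (Equivalence.from T-∨ (inj₂ (≤⇒≤ᵇ k≤last)))

  A-nonEdge : NonEdge (H k) A
  A-nonEdge = ∣A∣ , trans (cong (λ b → (∣ A ∣ ≡ᵇ k) ∧ (not b ∧ not (A ≡ˢ B))) ≡ˢ-refl) (∧-zeroʳ _)

  B-nonEdge : NonEdge (H k) B
  B-nonEdge = ∣B∣ , trans (cong (λ b → (∣ B ∣ ≡ᵇ k) ∧ (not (B ≡ˢ A) ∧ not b)) ≡ˢ-refl)
                          (trans (cong ((∣ B ∣ ≡ᵇ k) ∧_) (∧-zeroʳ _)) (∧-zeroʳ _))

  -- Every copy of K^k_{2k-2} in H_k is the complement of vertex 0, the only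
  -- vertex lying in both non-edges A and B.
  clique-form : ∀ {S} → IsClique (H k) N′ S → ∃ λ v → toℕ v ≡ 0 × S ≡ ∁ ⁅ v ⁆
  clique-form {S} S-clique@(∣S∣ , _) with co-point S ∣S∣
  ... | v , S≡∁v =
    v , A∩B-vertex (removed₁-member {k} (meets A-nonEdge)) (removed₂-member {k} (meets B-nonEdge)) , S≡∁v
    where
      meets : ∀ {e} → NonEdge (H k) e → v ∈ e
      meets = co-point-clique-meets (H k) (subst (IsClique (H k) N′) S≡∁v S-clique)

  -- |E(H_k)| + 2 = C(2k-1, k): exactly the k-sets A and B are missing.
  H-edgeCount : numEdges (H k) + 2 ≡ count (isKSet k) (allSubsets N)
  H-edgeCount = sym (begin
    count q xs                                ≡⟨ count-without q (isKSet-true A ∣A∣) ⟩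
    count (q without A) xs + 1                ≡⟨ cong (_+ 1) (count-without (q without A) B-in-q∖A) ⟩
    count ((q without A) without B) xs + 1 + 1 ≡⟨ +-assoc _ 1 1 ⟩
    count ((q without A) without B) xs + 2    ≡⟨ cong (_+ 2) (count-cong (λ x → ∧-assoc (q x) _ _) xs) ⟩
    numEdges (H k) + 2                        ∎)
    where
      open ≡-Reasoning
      q : Subset N → Bool
      q = isKSet k
      xs : List (Subset N)
      xs = allSubsets N
      B-in-q∖A : (q without A) B ≡ true
      B-in-q∖A = without-keeps q (isKSet-true B ∣B∣) B≢A

mainTheorem1 : (k : ℕ) → 2 ≤ k →
    (¬ (Σ (Subset (2 * k ∸ 1)) λ S → Σ (Subset (2 * k ∸ 1)) λ T →
          S ≢ T × IsClique (H k) (2 * k ∸ 2) S × IsClique (H k) (2 * k ∸ 2) T))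
    × (∀ t → IsTuranNumber (2 * k ∸ 1) (2 * k ∸ 2) k t → t + 1 ≤ numEdges (H k))
mainTheorem1 (suc (suc m)) _ = at-most-one-copy , above-Turán-number
  where
    open Hₖ m

    -- (1) both copies are the complement of vertex 0
    at-most-one-copy : ¬ (Σ (Subset N) λ S → Σ (Subset N) λ T →
                          S ≢ T × IsClique (H k) N′ S × IsClique (H k) N′ T)
    at-most-one-copy (S , T , S≢T , S-clique , T-clique) with clique-form S-clique | clique-form T-clique
    ... | v , v≡0 , S≡∁v | w , w≡0 , T≡∁w =
      S≢T (trans S≡∁v (trans (cong (∁ ∘ ⁅_⁆) (toℕ-injective (trans v≡0 (sym w≡0)))) (sym T≡∁w)))

    above-Turán-number : ∀ t → IsTuranNumber N N′ k t → t + 1 ≤ numEdges (H k)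
    above-Turán-number t ((G , K-free , refl) , _) = +-cancelʳ-≤ 2 (numEdges G + 1) (numEdges (H k)) (begin
      numEdges G + 1 + 2                  ≡⟨ +-assoc (numEdges G) 1 2 ⟩
      numEdges G + 3                      ≤⟨ K-free-edge-bound G (s≤s z≤n) N<k+k K-free ⟩
      count (isKSet k) (allSubsets N)     ≡⟨ sym H-edgeCount ⟩
      numEdges (H k) + 2                  ∎)
      where open ≤-Reasoning
mainTheorem1 (suc zero) (s≤s ())
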